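{- Let $\sigma\ge2$, $k\ge1$, let $U$ be any rotation of a $\sigma$-ary de Bruijn sequence of order $k$, and let $w_{\mathrm{lin}}=U\,U[0..k-2]$, a string of length $\sigma^k+k-1$. Then $\operatorname{sre}(w_{\mathrm{lin}})=\sigma^k$.
   Context: A $\sigma$-ary de Bruijn sequence of order $k$ over an alphabet $\Sigma$ of size $\sigma$ is a cyclic word of length $\sigma^k$ whose cyclic length-$k$ windows are exactly the words of $\Sigma^k$, each occurring once. Strings are 0-indexed; $U[0..k-2]$ is the prefix of length $k-1$ (empty if $k=1$). For a string $w$, a substring $x$ (possibly empty) is right-maximal if $xa$ and $xb$ are substrings of $w$ for some distinct letters $a\neq b$; the set $E_r(w)$ of right-extensions consists of the substrings $xa$ with $x$ right-maximal. The super-maximal extensions are $S_r(w)=\{x\in E_r(w): \text{whenever } y=zx \text{ with } y\in E_r(w), \ z \text{ is empty}\}$, i.e. right-extensions that are not a proper suffix of another right-extension, and $\operatorname{sre}(w)=|S_r(w)|$. -}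

module Defs where

open import Data.Nat using (ℕ; _<_; _^_)
open import Data.Fin using (Fin)
open import Data.List using (List; []; _∷_; _++_; length; take; drop; [_])
open import Data.List.Relation.Unary.Unique.Propositional using (Unique)
open import Data.List.Membership.Propositional using (_∈_)
open import Data.Product using (Σ; ∃; ∃-syntax; _×_; _,_)
open import Relation.Binary.PropositionalEquality using (_≡_; _≢_)
open import Function.Bundles using (_⇔_)

Word : ℕ → Set
Word σ = List (Fin σ)

-- Cyclic window of length k starting at position i of the cyclic word U.
-- For i < |U| and k ≤ |U| this is exactly U[i] U[i+1 mod |U|] … U[i+k-1 mod |U|].
cycWindow : ∀ {σ} → Word σ → ℕ → ℕ → Word σ
cycWindow U k i = take k (drop i (U ++ U))

IsDeBruijn : (σ k : ℕ) → Word σ → Set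
IsDeBruijn σ k U =
  length U ≡ σ ^ k ×
  ((x : Word σ) → length x ≡ k →
     Σ ℕ λ i → i < σ ^ k × cycWindow U k i ≡ x ×
       ((j : ℕ) → j < σ ^ k → cycWindow U k j ≡ x → j ≡ i))

rotate : ∀ {σ} → Word σ → ℕ → Word σ
rotate U r = drop r U ++ take r U

IsSubstring : ∀ {σ} → Word σ → Word σ → Set
IsSubstring x w = ∃[ u ] ∃[ v ] (u ++ x ++ v ≡ w)

RightMaximal : ∀ {σ} → Word σ → Word σ → Set
RightMaximal {σ} w x =
  Σ (Fin σ) λ a → Σ (Fin σ) λ b →
    a ≢ b × IsSubstring (x ++ [ a ]) w × IsSubstring (x ++ [ b ]) w

InEr : ∀ {σ} → Word σ → Word σ → Set
InEr {σ} w y =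
  Σ (Word σ) λ x → Σ (Fin σ) λ a →
    y ≡ x ++ [ a ] × RightMaximal w x × IsSubstring (x ++ [ a ]) w

InSr : ∀ {σ} → Word σ → Word σ → Set
InSr {σ} w y =
  InEr w y × ((z y′ : Word σ) → InEr w y′ → y′ ≡ z ++ y → z ≡ [])

SreIs : ∀ {σ} → Word σ → ℕ → Set
SreIs {σ} w n =
  Σ (List (Word σ)) λ L →
    Unique L × ((y : Word σ) → (y ∈ L ⇔ InSr w y)) × length L ≡ n

-- A rotation U of a de Bruijn sequence is again de Bruijn, since rotating by r
-- sends the cyclic window at i to the one at (i + r) mod σ^k. In w = U U[0..k-2]
-- every word of length k occurs, and an occurrence followed by a further letter
-- starts inside U, so it is one of the σ^k pairwise distinct cyclic windows of U;
-- hence no word of length ≥ k is right-maximal, while every shorter word is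
-- (σ ≥ 2). So E_r(w) consists of the nonempty words of length at most k, and
-- S_r(w) of the σ^k words of length exactly k, enumerated by the windows of U.
module Submission where

open import Defs
open import Data.Fin using (zero; suc)
open import Data.List using (List; []; _∷_; _++_; _∷ʳ_; length; take; drop; [_]; replicate; initLast; _∷ʳ′_; applyUpTo)
open import Data.List.Properties using (++-assoc; length-++; length-drop; length-take; take++drop≡id; length-++-≤ʳ; length-++-≤ˡ; length-replicate; length-applyUpTo; take-all; ++-cancelˡ; ∷-injectiveˡ)
open import Data.Nat using (ℕ; zero; suc; _+_; _∸_; _^_; _≤_; _<_; NonZero; s≤s; z≤n; z<s; >-nonZero⁻¹)
open import Data.Nat.DivMod using (_%_; m%n<n; m<n⇒m%n≡m; [m+n]%n≡m%n; %-distribˡ-+; m%n%n≡m%n)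
open import Data.Nat.Properties
open import Data.List.Membership.Propositional using (_∈_)
open import Data.List.Membership.Propositional.Properties using (∈-applyUpTo⁺; ∈-applyUpTo⁻)
open import Data.List.Relation.Unary.Unique.Propositional using (Unique)
open import Data.List.Relation.Unary.Unique.Propositional.Properties using (applyUpTo⁺₁)
open import Data.Product using (_,_; _×_; proj₁; proj₂)
open import Data.Sum using (inj₁; inj₂)
open import Function.Bundles using (_⇔_; mk⇔)
open import Function.Properties.Equivalence using () renaming (trans to ⇔-trans; sym to ⇔-sym)
open import Function using (_∘′_)
open import Relation.Binary.PropositionalEquality hiding ([_])
open import Relation.Nullary using (yes; no; ¬_; contradiction)

n<2^n : ∀ n → n < 2 ^ n
n<2^n zero = z<s
n<2^n (suc n) = +-mono-≤ (≤-trans (s≤s z≤n) (n<2^n n)) (subst (suc n ≤_) (sym (+-identityʳ (2 ^ n))) (n<2^n n))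

n≤σ^n : ∀ {σ} n → 2 ≤ σ → n ≤ σ ^ n
n≤σ^n n 2≤σ = ≤-trans (<⇒≤ (n<2^n n)) (^-monoˡ-≤ n 2≤σ)

[m%n+k]%n≡[m+k]%n : ∀ m k n .{{_ : NonZero n}} → (m % n + k) % n ≡ (m + k) % n
[m%n+k]%n≡[m+k]%n m k n = begin
  (m % n + k) % n         ≡⟨ %-distribˡ-+ (m % n) k n ⟩
  (m % n % n + k % n) % n ≡⟨ cong (λ x → (x + k % n) % n) (m%n%n≡m%n m n) ⟩
  (m % n + k % n) % n     ≡⟨ %-distribˡ-+ m k n ⟨
  (m + k) % n             ∎
  where open ≡-Reasoning

%-shift-inverse : ∀ {n s t i} .{{_ : NonZero n}} → s + t ≡ n → i < n → ((i + s) % n + t) % n ≡ i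
%-shift-inverse {n} {s} {t} {i} s+t≡n i<n = begin
  ((i + s) % n + t) % n ≡⟨ [m%n+k]%n≡[m+k]%n (i + s) t n ⟩
  (i + s + t) % n       ≡⟨ cong (_% n) (trans (+-assoc i s t) (cong (i +_) s+t≡n)) ⟩
  (i + n) % n           ≡⟨ [m+n]%n≡m%n i n ⟩
  i % n                 ≡⟨ m<n⇒m%n≡m i<n ⟩
  i                     ∎
  where open ≡-Reasoning

private variable
  A : Set
  xs ys : List A

drop-++ˡ : ∀ {n} → n ≤ length xs → drop n (xs ++ ys) ≡ drop n xs ++ ys
drop-++ˡ {n = zero} _ = refl
drop-++ˡ {xs = x ∷ xs} {n = suc n} (s≤s n≤) = drop-++ˡ {xs = xs} n≤

length-take-≤ : ∀ {n} → n ≤ length xs → length (take n xs) ≡ n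
length-take-≤ {xs = xs} {n} n≤ = trans (length-take n xs) (m≤n⇒m⊓n≡m n≤)

length-∷ʳ : ∀ {x : A} (xs : List A) → length (xs ∷ʳ x) ≡ suc (length xs)
length-∷ʳ [] = refl
length-∷ʳ (_ ∷ xs) = cong suc (length-∷ʳ xs)

drop-length-++ : ∀ {n} (xs : List A) → drop (length xs + n) (xs ++ ys) ≡ drop n ys
drop-length-++ [] = refl
drop-length-++ (x ∷ xs) = drop-length-++ xs

take-++-≤ : ∀ {k} → k ≤ length xs → take k (xs ++ ys) ≡ take k xs
take-++-≤ {k = zero} _ = refl
take-++-≤ {xs = x ∷ xs} {k = suc k} (s≤s k≤) = cong (x ∷_) (take-++-≤ k≤)

length-rotate : ∀ {σ} (D : Word σ) r → length (rotate D r) ≡ length D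
length-rotate D r = begin
  length (drop r D ++ take r D)         ≡⟨ length-++ (drop r D) ⟩
  length (drop r D) + length (take r D) ≡⟨ +-comm (length (drop r D)) _ ⟩
  length (take r D) + length (drop r D) ≡⟨ length-++ (take r D) ⟨
  length (take r D ++ drop r D)         ≡⟨ cong length (take++drop≡id r D) ⟩
  length D                              ∎
  where open ≡-Reasoning

module _ {σ : ℕ} (D : Word σ) {r : ℕ} (r≤ : r ≤ length D) where
  private
    B C : Word σ
    B = take r D
    C = drop r D

    B++C : B ++ C ≡ D
    B++C = take++drop≡id r D

    length-B : length B ≡ r
    length-B = length-take-≤ r≤

    C+r : length C + r ≡ length D
    C+r = trans (cong (_+ r) (length-drop r D)) (m∸n+n≡m r≤)

  cycWindow-rotate-front : ∀ {k i} → k ≤ length D → i ≤ length C →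
    cycWindow (rotate D r) k i ≡ cycWindow D k (r + i)
  cycWindow-rotate-front {k = k} {i} k≤ i≤ = begin
    take k (drop i ((C ++ B) ++ C ++ B))  ≡⟨ cong (take k ∘′ drop i) (doubled-rotation) ⟩
    take k (drop i (C ++ D ++ B))         ≡⟨ cong (take k) (drop-++ˡ i≤) ⟩
    take k (drop i C ++ D ++ B)           ≡⟨ cong (take k) (++-assoc (drop i C) D B) ⟨
    take k ((drop i C ++ D) ++ B)         ≡⟨ take-++-≤ (≤-trans k≤ (length-++-≤ʳ D {drop i C})) ⟩
    take k (drop i C ++ D)                ≡⟨ cong (take k) (drop-++ˡ i≤) ⟨
    take k (drop i (C ++ D))              ≡⟨ cong (take k) (drop-length-++ B) ⟨
    take k (drop (length B + i) (B ++ C ++ D)) ≡⟨ cong₂ (λ m z → take k (drop m z)) (cong (_+ i) length-B) doubled ⟩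
    take k (drop (r + i) (D ++ D))        ∎
    where
      open ≡-Reasoning
      doubled-rotation : (C ++ B) ++ C ++ B ≡ C ++ D ++ B
      doubled-rotation = trans (++-assoc C B (C ++ B)) (cong (C ++_) (trans (sym (++-assoc B C B)) (cong (_++ B) B++C)))
      doubled : B ++ C ++ D ≡ D ++ D
      doubled = trans (sym (++-assoc B C D)) (cong (_++ D) B++C)

  cycWindow-rotate-back : ∀ {k j} → k ≤ length D → j ≤ r →
    cycWindow (rotate D r) k (length C + j) ≡ cycWindow D k j
  cycWindow-rotate-back {k = k} {j} k≤ j≤ = begin
    take k (drop (length C + j) (U ++ U))      ≡⟨ cong (take k ∘′ drop (length C + j)) (++-assoc C B U) ⟩
    take k (drop (length C + j) (C ++ B ++ U)) ≡⟨ cong (take k) (drop-length-++ C) ⟩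
    take k (drop j (B ++ U))                   ≡⟨ cong (take k) (drop-++ˡ j≤B) ⟩
    take k (drop j B ++ U)                     ≡⟨ take-++-≤ (≤-trans k≤U (length-++-≤ʳ U {drop j B})) ⟨
    take k ((drop j B ++ U) ++ C)              ≡⟨ cong (take k) (++-assoc (drop j B) U C) ⟩
    take k (drop j B ++ U ++ C)                ≡⟨ cong (take k) (drop-++ˡ j≤B) ⟨
    take k (drop j (B ++ U ++ C))              ≡⟨ cong (take k ∘′ drop j) doubled ⟩
    take k (drop j (D ++ D))                   ∎
    where
      open ≡-Reasoning
      U = rotate D r
      j≤B : j ≤ length B
      j≤B = subst (j ≤_) (sym length-B) j≤
      k≤U : k ≤ length U
      k≤U = subst (k ≤_) (sym (length-rotate D r)) k≤
      doubled : B ++ U ++ C ≡ D ++ D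
      doubled = begin
        B ++ (C ++ B) ++ C ≡⟨ cong (B ++_) (++-assoc C B C) ⟩
        B ++ C ++ B ++ C   ≡⟨ ++-assoc B C (B ++ C) ⟨
        (B ++ C) ++ B ++ C ≡⟨ cong (λ z → z ++ z) B++C ⟩
        D ++ D             ∎

  cycWindow-rotate : .{{_ : NonZero (length D)}} → ∀ {k i} → k ≤ length D → i < length D →
    cycWindow (rotate D r) k i ≡ cycWindow D k ((i + r) % length D)
  cycWindow-rotate {k = k} {i} k≤ i<D with i <? length C
  ... | yes i<C = trans (cycWindow-rotate-front k≤ (<⇒≤ i<C)) (cong (cycWindow D k) (sym i+r%D))
    where
      i+r%D : (i + r) % length D ≡ r + i
      i+r%D = trans (m<n⇒m%n≡m (subst (i + r <_) C+r (+-monoˡ-< r i<C))) (+-comm i r)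
  ... | no i≮C = begin
    cycWindow (rotate D r) k i              ≡⟨ cong (cycWindow (rotate D r) k) i≡C+j ⟩
    cycWindow (rotate D r) k (length C + j) ≡⟨ cycWindow-rotate-back k≤ (<⇒≤ j<r) ⟩
    cycWindow D k j                         ≡⟨ cong (cycWindow D k) i+r%D ⟨
    cycWindow D k ((i + r) % length D)      ∎
    where
      open ≡-Reasoning
      j = i ∸ length C
      i≡C+j : i ≡ length C + j
      i≡C+j = sym (m+[n∸m]≡n (≮⇒≥ i≮C))
      j<r : j < r
      j<r = +-cancelˡ-< (length C) j r (subst₂ _<_ i≡C+j (sym C+r) i<D)
      i+r%D : (i + r) % length D ≡ j
      i+r%D = begin
        (i + r) % length D              ≡⟨ cong (λ m → (m + r) % length D) i≡C+j ⟩
        (length C + j + r) % length D   ≡⟨ cong (_% length D) (C+j+r≡j+D) ⟩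
        (j + length D) % length D       ≡⟨ [m+n]%n≡m%n j (length D) ⟩
        j % length D                    ≡⟨ m<n⇒m%n≡m (≤-trans j<r r≤) ⟩
        j                               ∎
        where
          C+j+r≡j+D : length C + j + r ≡ j + length D
          C+j+r≡j+D = trans (cong (_+ r) (+-comm (length C) j)) (trans (+-assoc j (length C) r) (cong (j +_) C+r))

IsDeBruijn-reindex : ∀ {σ k} {U V : Word σ} (f g : ℕ → ℕ) →
  length V ≡ σ ^ k →
  (∀ {i} → i < σ ^ k → f i < σ ^ k) → (∀ {j} → j < σ ^ k → g j < σ ^ k) →
  (∀ {i} → i < σ ^ k → g (f i) ≡ i) → (∀ {j} → j < σ ^ k → f (g j) ≡ j) →
  (∀ {i} → i < σ ^ k → cycWindow V k i ≡ cycWindow U k (f i)) →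
  IsDeBruijn σ k U → IsDeBruijn σ k V
IsDeBruijn-reindex {k = k} {U} f g lengthV f< g< gf fg window (_ , occursOnce) = lengthV , λ x ∣x∣≡k →
  let j , j< , window-j , j-unique = occursOnce x ∣x∣≡k in
  g j , g< j< , trans (window (g< j<)) (trans (cong (cycWindow U k) (fg j<)) window-j) ,
  λ i i< window-i → trans (sym (gf i<)) (cong g (j-unique (f i) (f< i<) (trans (sym (window i<)) window-i)))

IsDeBruijn-rotate : ∀ {σ k r} .{{_ : NonZero σ}} {D : Word σ} → k ≤ σ ^ k → r ≤ length D →
  IsDeBruijn σ k D → IsDeBruijn σ k (rotate D r)
IsDeBruijn-rotate {σ} {k} {r} {D} k≤n r≤D db@(lengthD , _) =
  IsDeBruijn-reindex {U = D} {V = rotate D r} (λ i → (i + r) % length D) (λ j → (j + (length D ∸ r)) % length D)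
    (trans (length-rotate D r) lengthD) (λ _ → %<n) (λ _ → %<n)
    (λ i< → %-shift-inverse (m+[n∸m]≡n r≤D) (toD i<)) (λ j< → %-shift-inverse (m∸n+n≡m r≤D) (toD j<))
    (λ i< → cycWindow-rotate D r≤D (subst (k ≤_) (sym lengthD) k≤n) (toD i<)) db
  where
    instance
      nonZero-D : NonZero (length D)
      nonZero-D = subst NonZero (sym lengthD) (m^n≢0 σ k)
    toD : ∀ {i} → i < σ ^ k → i < length D
    toD {i} = subst (i <_) (sym lengthD)
    %<n : ∀ {m} → m % length D < σ ^ k
    %<n {m} = subst (m % length D <_) lengthD (m%n<n m (length D))

module _ {σ : ℕ} {w : Word σ} where

  IsSubstring-++⁻ˡ : (x : Word σ) {y : Word σ} → IsSubstring (x ++ y) w → IsSubstring x w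
  IsSubstring-++⁻ˡ x {y} (u , v , u++xy++v≡w) = u , y ++ v , trans (cong (u ++_) (sym (++-assoc x y v))) u++xy++v≡w

  IsSubstring-++⁻ʳ : (x : Word σ) {y : Word σ} → IsSubstring (x ++ y) w → IsSubstring y w
  IsSubstring-++⁻ʳ x {y} (u , v , u++xy++v≡w) = u ++ x , v , (begin
    (u ++ x) ++ y ++ v  ≡⟨ ++-assoc u x (y ++ v) ⟩
    u ++ x ++ y ++ v    ≡⟨ cong (u ++_) (++-assoc x y v) ⟨
    u ++ (x ++ y) ++ v  ≡⟨ u++xy++v≡w ⟩
    w                   ∎)
    where open ≡-Reasoning

  RightMaximal-++⁻ʳ : (x : Word σ) {z : Word σ} → RightMaximal w (x ++ z) → RightMaximal w z
  RightMaximal-++⁻ʳ x {z} (a , b , a≢b , xza , xzb) = a , b , a≢b , suffix xza , suffix xzb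
    where
      suffix : ∀ {c} → IsSubstring ((x ++ z) ++ [ c ]) w → IsSubstring (z ++ [ c ]) w
      suffix {c} = IsSubstring-++⁻ʳ x ∘′ subst (λ t → IsSubstring t w) (++-assoc x z [ c ])

module RightExtensions {s : ℕ} (w : Word (suc (suc s))) (k : ℕ) .{{_ : NonZero k}}
  (complete : ∀ z → length z ≡ k → IsSubstring z w)
  (deterministic : ∀ z → length z ≡ k → ¬ RightMaximal w z) where

  IsSubstring-≤ : ∀ y → length y ≤ k → IsSubstring y w
  IsSubstring-≤ y ∣y∣≤k = IsSubstring-++⁻ˡ y (complete (y ++ padding) length-padded)
    where
      padding = replicate (k ∸ length y) zero
      length-padded : length (y ++ padding) ≡ k
      length-padded = trans (length-++ y) (trans (cong (length y +_) (length-replicate _)) (m+[n∸m]≡n ∣y∣≤k))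

  RightMaximal-< : ∀ x → length x < k → RightMaximal w x
  RightMaximal-< x ∣x∣<k = zero , suc zero , (λ ()) , IsSubstring-≤ _ ∣xc∣≤k , IsSubstring-≤ _ ∣xc∣≤k
    where
      ∣xc∣≤k : ∀ {c} → length (x ∷ʳ c) ≤ k
      ∣xc∣≤k = subst (_≤ k) (sym (length-∷ʳ x)) ∣x∣<k

  ¬RightMaximal-≥ : ∀ x → k ≤ length x → ¬ RightMaximal w x
  ¬RightMaximal-≥ x k≤∣x∣ =
    deterministic (drop m x) (trans (length-drop m x) (m∸[m∸n]≡n k≤∣x∣))
    ∘′ RightMaximal-++⁻ʳ (take m x)
    ∘′ subst (RightMaximal w) (sym (take++drop≡id m x))
    where m = length x ∸ k

  length-InEr : ∀ {y} → InEr w y → length y ≤ k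
  length-InEr (x , _ , refl , rm , _) =
    subst (_≤ k) (sym (length-∷ʳ x)) (≰⇒> (λ k≤∣x∣ → ¬RightMaximal-≥ x k≤∣x∣ rm))

  InEr-≤ : ∀ {y} → 0 < length y → length y ≤ k → InEr w y
  InEr-≤ {y} _ _ with initLast y
  InEr-≤ () _ | []
  InEr-≤ _ ∣y∣≤k | x ∷ʳ′ a =
    x , a , refl , RightMaximal-< x (subst (_≤ k) (length-∷ʳ x) ∣y∣≤k) , IsSubstring-≤ _ ∣y∣≤k

  InSr⇔length≡ : ∀ y → InSr w y ⇔ length y ≡ k
  InSr⇔length≡ y = mk⇔ to from
    where
      to : InSr w y → length y ≡ k
      to (er , maximal) with m≤n⇒m<n∨m≡n (length-InEr er)
      ... | inj₂ ∣y∣≡k = ∣y∣≡k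
      ... | inj₁ ∣y∣<k with () ← maximal [ zero ] (zero ∷ y) (InEr-≤ z<s ∣y∣<k) refl
      from : length y ≡ k → InSr w y
      from ∣y∣≡k = InEr-≤ (subst (0 <_) (sym ∣y∣≡k) (>-nonZero⁻¹ k)) (≤-reflexive ∣y∣≡k) , maximal
        where
          maximal : (z y′ : Word (suc (suc s))) → InEr w y′ → y′ ≡ z ++ y → z ≡ []
          maximal [] _ _ _ = refl
          maximal (c ∷ z) _ er′ refl =
            contradiction (length-InEr er′) (<⇒≱ (s≤s (subst (_≤ length (z ++ y)) ∣y∣≡k (length-++-≤ʳ y {z}))))

module DeBruijn {σ k : ℕ} (U : Word σ) (db : IsDeBruijn σ k U) (k≤n : k ≤ σ ^ k) where

  windows : List (Word σ)
  windows = applyUpTo (cycWindow U k) (σ ^ k)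

  length-cycWindow : ∀ {i} → i < σ ^ k → length (cycWindow U k i) ≡ k
  length-cycWindow {i} i<n = length-take-≤ (begin
    k                             ≤⟨ k≤n ⟩
    σ ^ k                         ≤⟨ m≤m+n (σ ^ k) (σ ^ k ∸ i) ⟩
    σ ^ k + (σ ^ k ∸ i)           ≡⟨ +-∸-assoc (σ ^ k) (<⇒≤ i<n) ⟨
    σ ^ k + σ ^ k ∸ i             ≡⟨ cong (_∸ i) (trans (length-++ U) (cong₂ _+_ (proj₁ db) (proj₁ db))) ⟨
    length (U ++ U) ∸ i           ≡⟨ length-drop i (U ++ U) ⟨
    length (drop i (U ++ U))      ∎)
    where open ≤-Reasoning

  cycWindow-injective : ∀ {i j} → i < σ ^ k → j < σ ^ k → cycWindow U k i ≡ cycWindow U k j → i ≡ j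
  cycWindow-injective {i} {j} i<n j<n wi≡wj with proj₂ db (cycWindow U k j) (length-cycWindow j<n)
  ... | _ , _ , _ , unique = trans (unique i i<n wi≡wj) (sym (unique j j<n refl))

  windows-unique : Unique windows
  windows-unique = applyUpTo⁺₁ (cycWindow U k) (σ ^ k)
    (λ i<j j<n wi≡wj → <⇒≢ i<j (cycWindow-injective (<-trans i<j j<n) j<n wi≡wj))

  ∈-windows⇔length≡ : ∀ y → y ∈ windows ⇔ length y ≡ k
  ∈-windows⇔length≡ y = mk⇔ to from
    where
      to : y ∈ windows → length y ≡ k
      to y∈ with i , i<n , refl ← ∈-applyUpTo⁻ (cycWindow U k) y∈ = length-cycWindow i<n
      from : length y ≡ k → y ∈ windows
      from ∣y∣≡k with i , i<n , refl , _ ← proj₂ db y ∣y∣≡k = ∈-applyUpTo⁺ (cycWindow U k) i<n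

module LinearDeBruijn {σ k′ : ℕ} (U : Word σ) (db : IsDeBruijn σ (suc k′) U) (k≤n : suc k′ ≤ σ ^ suc k′) where
  open DeBruijn U db k≤n

  private
    k n : ℕ
    k = suc k′
    n = σ ^ k

    U≡n : length U ≡ n
    U≡n = proj₁ db

    k′≤U : k′ ≤ length U
    k′≤U = subst (k′ ≤_) (sym U≡n) (<⇒≤ k≤n)

    k≤length-drop-++-take : ∀ {p} → p < n → k ≤ length (drop p U ++ take k′ U)
    k≤length-drop-++-take {p} p<n = begin
      1 + k′                                  ≤⟨ +-monoˡ-≤ k′ (m<n⇒0<n∸m p<n) ⟩
      n ∸ p + k′                              ≡⟨ cong₂ _+_ (trans (cong (_∸ p) (sym U≡n)) (sym (length-drop p U))) (sym (length-take-≤ k′≤U)) ⟩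
      length (drop p U) + length (take k′ U) ≡⟨ length-++ (drop p U) ⟨
      length (drop p U ++ take k′ U)          ∎
      where open ≤-Reasoning

  w : Word σ
  w = U ++ take k′ U

  length-w : length w ≡ n + k′
  length-w = trans (length-++ U) (cong₂ _+_ U≡n (length-take-≤ k′≤U))

  take-drop-w : ∀ {p} → p < n → take k (drop p w) ≡ cycWindow U k p
  take-drop-w {p} p<n = begin
    take k (drop p (U ++ take k′ U))               ≡⟨ cong (take k) (drop-++ˡ p≤U) ⟩
    take k (drop p U ++ take k′ U)                 ≡⟨ take-++-≤ (k≤length-drop-++-take p<n) ⟨
    take k ((drop p U ++ take k′ U) ++ drop k′ U)  ≡⟨ cong (take k) (++-assoc (drop p U) _ _) ⟩
    take k (drop p U ++ take k′ U ++ drop k′ U)    ≡⟨ cong (λ t → take k (drop p U ++ t)) (take++drop≡id k′ U) ⟩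
    take k (drop p U ++ U)                         ≡⟨ cong (take k) (drop-++ˡ p≤U) ⟨
    take k (drop p (U ++ U))                       ∎
    where
      open ≡-Reasoning
      p≤U : p ≤ length U
      p≤U = subst (p ≤_) (sym U≡n) (<⇒≤ p<n)

  complete : ∀ z → length z ≡ k → IsSubstring z w
  complete z ∣z∣≡k with p , p<n , window-p≡z , _ ← proj₂ db z ∣z∣≡k =
    take p w , drop k (drop p w) , (begin
      take p w ++ z ++ drop k (drop p w)                    ≡⟨ cong (λ t → take p w ++ t ++ drop k (drop p w)) z≡take ⟩
      take p w ++ take k (drop p w) ++ drop k (drop p w)    ≡⟨ cong (take p w ++_) (take++drop≡id k (drop p w)) ⟩
      take p w ++ drop p w                                  ≡⟨ take++drop≡id p w ⟩
      w                                                     ∎)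
    where
      open ≡-Reasoning
      z≡take : z ≡ take k (drop p w)
      z≡take = sym (trans (take-drop-w p<n) window-p≡z)

  occurrence : ∀ u z v {a} → u ++ (z ++ [ a ]) ++ v ≡ w → length z ≡ k →
    length u < n × drop (length u) w ≡ z ++ a ∷ v
  occurrence u z v {a} u++za++v≡w ∣z∣≡k =
    +-cancelʳ-≤ k′ (suc (length u)) n (subst (_≤ n + k′) (+-suc (length u) k′) ∣u∣+k≤n+k′) , (begin
      drop (length u) w                            ≡⟨ cong (drop (length u)) u++za++v≡w ⟨
      drop (length u) (u ++ (z ++ [ a ]) ++ v)     ≡⟨ cong (λ m → drop m (u ++ (z ++ [ a ]) ++ v)) (+-identityʳ (length u)) ⟨
      drop (length u + 0) (u ++ (z ++ [ a ]) ++ v) ≡⟨ drop-length-++ u ⟩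
      (z ++ [ a ]) ++ v                            ≡⟨ ++-assoc z [ a ] v ⟩
      z ++ a ∷ v                                   ∎)
    where
      open ≡-Reasoning
      -- An occurrence followed by a letter ends before |w| = σ^k + k - 1, so it starts inside U.
      k≤ : k ≤ length ((z ++ [ a ]) ++ v)
      k≤ = subst (_≤ length ((z ++ [ a ]) ++ v)) ∣z∣≡k (≤-trans (length-++-≤ˡ z) (length-++-≤ˡ (z ++ [ a ])))
      ∣u∣+k≤n+k′ : length u + k ≤ n + k′
      ∣u∣+k≤n+k′ = ≤-trans (+-monoʳ-≤ (length u) k≤)
        (≤-reflexive (trans (sym (length-++ u)) (trans (cong length u++za++v≡w) length-w)))

  deterministic : ∀ z → length z ≡ k → ¬ RightMaximal w z
  deterministic z ∣z∣≡k (a , b , a≢b , (u₁ , v₁ , occ₁) , (u₂ , v₂ , occ₂)) =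
    a≢b (∷-injectiveˡ (++-cancelˡ z _ _ (begin
      z ++ a ∷ v₁          ≡⟨ drop₁ ⟨
      drop (length u₁) w   ≡⟨ cong (λ m → drop m w) same-position ⟩
      drop (length u₂) w   ≡⟨ drop₂ ⟩
      z ++ b ∷ v₂          ∎)))
    where
      open ≡-Reasoning
      u₁<n = proj₁ (occurrence u₁ z v₁ occ₁ ∣z∣≡k)
      drop₁ = proj₂ (occurrence u₁ z v₁ occ₁ ∣z∣≡k)
      u₂<n = proj₁ (occurrence u₂ z v₂ occ₂ ∣z∣≡k)
      drop₂ = proj₂ (occurrence u₂ z v₂ occ₂ ∣z∣≡k)
      window≡z : ∀ {p c v} → p < n → drop p w ≡ z ++ c ∷ v → cycWindow U k p ≡ z
      window≡z {p} {c} {v} p<n drop≡ = begin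
        cycWindow U k p        ≡⟨ take-drop-w p<n ⟨
        take k (drop p w)      ≡⟨ cong (take k) drop≡ ⟩
        take k (z ++ c ∷ v)    ≡⟨ take-++-≤ (≤-reflexive (sym ∣z∣≡k)) ⟩
        take k z               ≡⟨ take-all k z (≤-reflexive ∣z∣≡k) ⟩
        z                      ∎
      same-position : length u₁ ≡ length u₂
      same-position = cycWindow-injective u₁<n u₂<n (trans (window≡z u₁<n drop₁) (sym (window≡z u₂<n drop₂)))

lemma5 : (σ k : ℕ) → 2 ≤ σ → 1 ≤ k →
    (D : Word σ) → IsDeBruijn σ k D →
    (r : ℕ) → r ≤ length D →
    let U = rotate D r in
    SreIs (U ++ take (k ∸ 1) U) (σ ^ k)
lemma5 σ@(suc (suc _)) k@(suc _) 2≤σ@(s≤s (s≤s z≤n)) _ D db r r≤D =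
  windows , windows-unique , (λ y → ⇔-trans (∈-windows⇔length≡ y) (⇔-sym (InSr⇔length≡ y))) ,
  length-applyUpTo (cycWindow U k) (σ ^ k)
  where
    U = rotate D r
    k≤n : k ≤ σ ^ k
    k≤n = n≤σ^n k 2≤σ
    db-U : IsDeBruijn σ k U
    db-U = IsDeBruijn-rotate k≤n r≤D db
    open DeBruijn U db-U k≤n
    open LinearDeBruijn U db-U k≤n
    open RightExtensions w k complete deterministic
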